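{- For every integer $t\ge 1$, let $K_t$ denote the complete graph on $t$ vertices. Then $\mathcal{L}(K_t)=1/t!$.
   Context: Random graph process ("construction"): start with $G_1$, the graph with the single vertex $1$ and no edges. For $t\ge 2$, the graph $G_t$ on vertex set $\{1,\dots,t\}$ is obtained from $G_{t-1}$ (on vertex set $\{1,\dots,t-1\}$) as follows, independently of all earlier choices: choose an integer $k\in\{0,1,\dots,t-1\}$ uniformly at random; then choose a $k$-element subset $S\subseteq\{1,\dots,t-1\}$ uniformly at random among all $\binom{t-1}{k}$ such subsets; then add the new vertex $t$ and the edges $\{s,t\}$ for all $s\in S$. For a finite simple graph $G$ on $t$ vertices, its (graph) likelihood is $\mathcal{L}(G):=\Pr[G_t\cong G]$, the probability that the graph produced after $t$ steps is isomorphic to $G$. -}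

module Defs where

open import Data.Bool using (Bool; true; false; not; if_then_else_)
open import Data.Nat using (ℕ; zero; suc)
open import Data.Nat.Combinatorics using (_C_)
open import Data.Fin using (Fin; zero; suc)
open import Data.Fin.Properties using (_≟_)
open import Data.Vec using (Vec; []; _∷_; lookup; count)
open import Data.List using (List; []; _∷_; map; concatMap; foldr)
open import Data.Product using (Σ; _×_; _,_)
open import Data.Unit using (⊤; tt)
open import Data.Integer using (+_)
open import Data.Rational using (ℚ; _/_; _*_; _+_; 0ℚ; 1ℚ)
open import Relation.Nullary using (Dec; does)
open import Relation.Binary.PropositionalEquality using (_≡_)
open import Function.Bundles using (_↔_; Inverse)

Graph : ℕ → Set
Graph n = Fin n → Fin n → Bool

K : (n : ℕ) → Graph n
K n i j = not (does (i ≟ j))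

_≅_ : {n : ℕ} → Graph n → Graph n → Set
_≅_ {n} G H = Σ (Fin n ↔ Fin n) λ σ →
  ∀ i j → G i j ≡ H (Inverse.to σ i) (Inverse.to σ j)

Subset : ℕ → Set
Subset n = Vec Bool n

allSubsets : (n : ℕ) → List (Subset n)
allSubsets zero = [] ∷ []
allSubsets (suc n) = concatMap (λ s → (true ∷ s) ∷ (false ∷ s) ∷ []) (allSubsets n)

size : {n : ℕ} → Subset n → ℕ
size {n} s = count (λ b → Data.Bool._≟_ b true) s
  where import Data.Bool

-- History of the process up to n vertices: the sequence of chosen sets.
-- Adding vertex number (n+1) (with n earlier vertices) records a subset of the
-- n earlier vertices.
Hist : ℕ → Set
Hist zero = ⊤
Hist (suc n) = Hist n × Subset n

allHist : (n : ℕ) → List (Hist n)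
allHist zero = tt ∷ []
allHist (suc n) = concatMap (λ h → map (λ s → (h , s)) (allSubsets n)) (allHist n)

-- The graph built by a history. The newest vertex is Fin index zero and
-- older vertices are shifted by suc (a relabelling; irrelevant up to ≅).
graphOf : {n : ℕ} → Hist n → Graph n
graphOf {zero} tt () _
graphOf {suc n} (h , S) zero zero = false
graphOf {suc n} (h , S) zero (suc j) = lookup S j
graphOf {suc n} (h , S) (suc i) zero = lookup S i
graphOf {suc n} (h , S) (suc i) (suc j) = graphOf h i j

-- 1/m as a rational (value at m = 0 is irrelevant and never used).
inv : ℕ → ℚ
inv zero = 0ℚ
inv (suc m) = (+ 1) / suc m

-- Probability of one step with n earlier vertices choosing the set S:
-- k = |S| uniform in {0..n} (prob 1/(n+1)), then S uniform among (n choose k).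
stepProb : (n : ℕ) → Subset n → ℚ
stepProb n S = inv (suc n) * inv (n C size S)

histProb : {n : ℕ} → Hist n → ℚ
histProb {zero} tt = 1ℚ
histProb {suc n} (h , S) = histProb h * stepProb n S

sumℚ : List ℚ → ℚ
sumℚ = foldr _+_ 0ℚ

-- Likelihood L(G) = Pr[G_t ≅ G], given any decision procedure for ≅ G
-- (all such procedures agree, so the value does not depend on it).
Likelihood : {t : ℕ} (G : Graph t) → ((h : Hist t) → Dec (graphOf h ≅ G)) → ℚ
Likelihood {t} G d =
  sumℚ (map (λ h → if does (d h) then histProb h else 0ℚ) (allHist t))

-- Only one history builds a complete graph: each new vertex must be joined to
-- all earlier ones, i.e. choose k = n out of n, which happens with probability
-- 1/(n+1) · 1/C(n,n) = 1/(n+1). The product of these over the t steps is 1/t!.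
module Submission where

open import Defs
open import Data.Nat using (ℕ; zero; suc; _≤_; _!; NonZero)
import Data.Nat as ℕ
open import Data.Nat.Properties using (_!≢0; *-comm)
open import Data.Nat.Combinatorics using (_C_; nCn≡1)
open import Data.Nat.Coprimality using (1-coprimeTo)
open import Data.Bool using (true; false; not; if_then_else_)
open import Data.Fin using (Fin; zero; suc)
open import Data.Fin.Properties using (suc-injective; _≟_)
open import Data.Vec using (_∷_; lookup; replicate)
import Data.Vec as Vec
open import Data.Vec.Properties using (lookup-replicate; ∷-injectiveʳ)
open import Data.List using (List; []; _∷_; map; concatMap; _++_)
open import Data.List.Properties using (map-∘)
open import Data.Unit using (tt)
open import Data.Product using (_,_; proj₁; proj₂)
open import Data.Rational using (ℚ; _*_; _+_; 0ℚ; 1ℚ)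
open import Data.Rational.Properties using (+-assoc; +-identityˡ; +-identityʳ; *-identityʳ; normalize-coprime)
open import Relation.Nullary using (Dec; does)
open import Relation.Nullary.Decidable using (dec-true; dec-false)
open import Relation.Binary.PropositionalEquality
  using (_≡_; _≢_; refl; sym; trans; cong; cong₂; module ≡-Reasoning)
open import Function using (_∘_)
open import Function.Bundles using (Inverse; Injection)
open import Function.Properties.Inverse using (Inverse⇒Injection)
open import Function.Construct.Identity using (↔-id)

sumℚ-++ : {A : Set} (f : A → ℚ) (xs ys : List A) →
  sumℚ (map f (xs ++ ys)) ≡ sumℚ (map f xs) + sumℚ (map f ys)
sumℚ-++ f []       ys = sym (+-identityˡ _)
sumℚ-++ f (x ∷ xs) ys =
  trans (cong (f x +_) (sumℚ-++ f xs ys)) (sym (+-assoc (f x) _ _))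

sumℚ-concatMap : {A B : Set} (f : B → ℚ) (g : A → List B) (xs : List A) →
  sumℚ (map f (concatMap g xs)) ≡ sumℚ (map (λ x → sumℚ (map f (g x))) xs)
sumℚ-concatMap f g []       = refl
sumℚ-concatMap f g (x ∷ xs) =
  trans (sumℚ-++ f (g x) (concatMap g xs)) (cong (sumℚ (map f (g x)) +_) (sumℚ-concatMap f g xs))

sumℚ-zero : {A : Set} (f : A → ℚ) → (∀ x → f x ≡ 0ℚ) → (xs : List A) →
  sumℚ (map f xs) ≡ 0ℚ
sumℚ-zero f f≡0 []       = refl
sumℚ-zero f f≡0 (x ∷ xs) rewrite f≡0 x | sumℚ-zero f f≡0 xs = refl

sumℚ-allSubsets-point : ∀ n (g : Subset n → ℚ) (s₀ : Subset n) →
  (∀ s → s ≢ s₀ → g s ≡ 0ℚ) → sumℚ (map g (allSubsets n)) ≡ g s₀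
sumℚ-allSubsets-point zero    g Vec.[]    _    = +-identityʳ _
sumℚ-allSubsets-point (suc n) g (b ∷ s₀) g≡0 =
  trans (sumℚ-concatMap g _ (allSubsets n))
        (trans (sumℚ-allSubsets-point n pairSum s₀ pairSum≡0) (pairSum-s₀ b g≡0))
  where
  pairSum : Subset n → ℚ
  pairSum s = sumℚ (map g ((true ∷ s) ∷ (false ∷ s) ∷ []))

  pairSum≡0 : ∀ s → s ≢ s₀ → pairSum s ≡ 0ℚ
  pairSum≡0 s s≢s₀
    rewrite g≡0 (true ∷ s) (s≢s₀ ∘ ∷-injectiveʳ) | g≡0 (false ∷ s) (s≢s₀ ∘ ∷-injectiveʳ)
    = refl

  pairSum-s₀ : ∀ b → (∀ s → s ≢ b ∷ s₀ → g s ≡ 0ℚ) → pairSum s₀ ≡ g (b ∷ s₀)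
  pairSum-s₀ true  g≡0 rewrite g≡0 (false ∷ s₀) (λ ()) = +-identityʳ _
  pairSum-s₀ false g≡0 rewrite g≡0 (true ∷ s₀) (λ ()) | +-identityʳ (g (false ∷ s₀)) =
    +-identityˡ _

sumℚ-allHist-point : ∀ n (f : Hist n → ℚ) (h₀ : Hist n) →
  (∀ h → h ≢ h₀ → f h ≡ 0ℚ) → sumℚ (map f (allHist n)) ≡ f h₀
sumℚ-allHist-point zero    f tt        _    = +-identityʳ _
sumℚ-allHist-point (suc n) f (h₀ , S₀) f≡0 =
  trans (sumℚ-concatMap f _ (allHist n))
        (trans (sumℚ-allHist-point n stepSum h₀ stepSum≡0) stepSum-h₀)
  where
  stepSum : Hist n → ℚ
  stepSum h = sumℚ (map f (map (h ,_) (allSubsets n)))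

  stepSum≡0 : ∀ h → h ≢ h₀ → stepSum h ≡ 0ℚ
  stepSum≡0 h h≢h₀ = trans (cong sumℚ (sym (map-∘ (allSubsets n))))
    (sumℚ-zero _ (λ S → f≡0 (h , S) (h≢h₀ ∘ cong proj₁)) (allSubsets n))

  stepSum-h₀ : stepSum h₀ ≡ f (h₀ , S₀)
  stepSum-h₀ = trans (cong sumℚ (sym (map-∘ (allSubsets n))))
    (sumℚ-allSubsets-point n (f ∘ (h₀ ,_)) S₀ (λ S S≢S₀ → f≡0 (h₀ , S) (S≢S₀ ∘ cong proj₂)))

completeHist : (n : ℕ) → Hist n
completeHist zero    = tt
completeHist (suc n) = completeHist n , replicate n true

graphOf-completeHist : ∀ n (i j : Fin n) → graphOf (completeHist n) i j ≡ K n i j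
graphOf-completeHist (suc n) zero    zero    = refl
graphOf-completeHist (suc n) zero    (suc j) = lookup-replicate j true
graphOf-completeHist (suc n) (suc i) zero    = lookup-replicate i true
graphOf-completeHist (suc n) (suc i) (suc j) = graphOf-completeHist n i j

completeHist-≅-K : ∀ n → graphOf (completeHist n) ≅ K n
completeHist-≅-K n = ↔-id _ , graphOf-completeHist n

lookup-true⇒≡replicate : ∀ {n} (S : Subset n) → (∀ j → lookup S j ≡ true) →
  S ≡ replicate n true
lookup-true⇒≡replicate Vec.[]  _        = refl
lookup-true⇒≡replicate (b ∷ S) all-true =
  cong₂ _∷_ (all-true zero) (lookup-true⇒≡replicate S (all-true ∘ suc))

complete⇒≡completeHist : ∀ n (h : Hist n) →
  (∀ i j → i ≢ j → graphOf h i j ≡ true) → h ≡ completeHist n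
complete⇒≡completeHist zero    tt      _        = refl
complete⇒≡completeHist (suc n) (h , S) complete = cong₂ _,_
  (complete⇒≡completeHist n h (λ i j i≢j → complete (suc i) (suc j) (i≢j ∘ suc-injective)))
  (lookup-true⇒≡replicate S (λ j → complete zero (suc j) (λ ())))

≅K⇒≡completeHist : ∀ n (h : Hist n) → graphOf h ≅ K n → h ≡ completeHist n
≅K⇒≡completeHist n h (σ , preserves) = complete⇒≡completeHist n h adjacent
  where
  adjacent : ∀ i j → i ≢ j → graphOf h i j ≡ true
  adjacent i j i≢j =
    trans (preserves i j) (cong not (dec-false (to i ≟ to j) (i≢j ∘ injective)))
    where open Inverse σ using (to)
          open Injection (Inverse⇒Injection σ) using (injective)

-- Both sides normalise to the same term once each 1/(suc a) is unfolded to its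
-- already-reduced mkℚ form.
inv-*-homo : ∀ m n .{{_ : NonZero m}} .{{_ : NonZero n}} →
  inv m * inv n ≡ inv (m ℕ.* n)
inv-*-homo (suc m) (suc n) =
  cong₂ _*_ (normalize-coprime (1-coprimeTo (suc m))) (normalize-coprime (1-coprimeTo (suc n)))

size-replicate-true : ∀ n → size (replicate n true) ≡ n
size-replicate-true zero    = refl
size-replicate-true (suc n) = cong suc (size-replicate-true n)

stepProb-all : ∀ n → stepProb n (replicate n true) ≡ inv (suc n)
stepProb-all n = begin
  inv (suc n) * inv (n C size (replicate n true)) ≡⟨ cong (λ k → inv (suc n) * inv (n C k)) (size-replicate-true n) ⟩
  inv (suc n) * inv (n C n)                       ≡⟨ cong (λ k → inv (suc n) * inv k) (nCn≡1 n) ⟩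
  inv (suc n) * 1ℚ                                ≡⟨ *-identityʳ _ ⟩
  inv (suc n)                                     ∎
  where open ≡-Reasoning

histProb-completeHist : ∀ n → histProb (completeHist n) ≡ inv (n !)
histProb-completeHist zero    = refl
histProb-completeHist (suc n) = begin
  histProb (completeHist n) * stepProb n (replicate n true) ≡⟨ cong₂ _*_ (histProb-completeHist n) (stepProb-all n) ⟩
  inv (n !) * inv (suc n)                                   ≡⟨ inv-*-homo (n !) (suc n) {{n !≢0}} ⟩
  inv (n ! ℕ.* suc n)                                       ≡⟨ cong inv (*-comm (n !) (suc n)) ⟩
  inv (suc n !)                                             ∎
  where open ≡-Reasoning

mainTheorem1 : (t : ℕ) → 1 ≤ t → (d : (h : Hist t) → Dec (graphOf h ≅ K t)) →
    Likelihood (K t) d ≡ inv (t !)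
mainTheorem1 t _ d = begin
  Likelihood (K t) d         ≡⟨ sumℚ-allHist-point t weight (completeHist t) weight-off-complete ⟩
  weight (completeHist t)    ≡⟨ cong (if_then histProb (completeHist t) else 0ℚ)
                                     (dec-true (d (completeHist t)) (completeHist-≅-K t)) ⟩
  histProb (completeHist t)  ≡⟨ histProb-completeHist t ⟩
  inv (t !)                  ∎
  where
  open ≡-Reasoning

  weight : Hist t → ℚ
  weight h = if does (d h) then histProb h else 0ℚ

  weight-off-complete : ∀ h → h ≢ completeHist t → weight h ≡ 0ℚ
  weight-off-complete h h≢complete
    rewrite dec-false (d h) (h≢complete ∘ ≅K⇒≡completeHist t h) = refl
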